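{- Let $n$ be a positive integer. For each $\lambda\in\mathcal{G_I}(n)$ let $\mathcal{G}_\lambda=\{\varrho_i(\lambda):1\leq i\leq m(\lambda)\}$. Then the sets $\mathcal{G}_\lambda$, $\lambda\in\mathcal{G_I}(n)$, are pairwise disjoint and \[ \mathcal{G}(n)=\bigcup_{\lambda\in\mathcal{G_I}(n)}\mathcal{G}_\lambda . \]
   Context: A partition is a finite multiset of positive integers; $\bar{\ell}(\lambda)$ is its number of distinct part values and $m(\lambda)$ the multiplicity of its largest part. A partition is gap-free if its distinct part values are consecutive integers. $\mathcal{G}(n)$ is the set of gap-free partitions of $n$, and $\mathcal{G_I}(n)$ is the set of gap-free partitions of $n$ with smallest part $1$ and odd largest part. For a gap-free partition $\mu$ with at least $r$ distinct parts, $\xi_r(\mu)$ is obtained by taking the $r$ smallest distinct part values $v$ of $\mu$ and, for each simultaneously, replacing one copy of $v$ by $v+1$. For a gap-free partition $\lambda$ with smallest part $1$, largest part $\ell=\bar{\ell}(\lambda)$ of multiplicity $m(\lambda)$, and $1\leq i\leq m(\lambda)$: let $\lambda^i_1$ be $\lambda$ with $i-1$ copies of its largest part $\ell$ deleted, let $\lambda^i_j=\xi_\ell(\lambda^i_{j-1})$ for $2\leq j\leq i$, and set $\varrho_i(\lambda)=\lambda^i_i$ (at each step the partition to which $\xi_\ell$ is applied is gap-free with at least $\ell$ distinct parts, so this is defined). -}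

module Defs where

open import Data.Nat using (ℕ; zero; suc; _+_; _*_; _∸_; _≤_; _<_; _≤ᵇ_; _≡ᵇ_)
open import Data.Nat.DivMod using (_%_)
open import Data.Bool using (Bool; true; false; if_then_else_)
open import Data.List using (List; []; _∷_; _++_; map; length; head; last; take; drop; reverse; foldr)
open import Data.List.Relation.Unary.All using (All)
open import Data.List.Relation.Unary.Linked using (Linked)
open import Data.Nat.ListAction using (sum)
open import Data.Maybe using (just)
open import Data.Product using (_×_; ∃)
open import Relation.Binary.PropositionalEquality using (_≡_)

-- Representation: a partition (finite multiset of positive integers) is
-- represented canonically by the list of its parts in NON-INCREASING
-- order (largest part first).  Two multisets are equal iff their
-- canonical lists are equal, so multiset equality is _≡_ on lists.

NonIncreasing : List ℕ → Set
NonIncreasing = Linked (λ x y → y ≤ x)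

IsPartitionOf : ℕ → List ℕ → Set
IsPartitionOf n λ′ = NonIncreasing λ′ × All (λ x → 0 < x) λ′ × sum λ′ ≡ n

-- gap-free: distinct part values are consecutive integers; for a
-- non-increasing list this means adjacent parts differ by 0 or 1
GapFree : List ℕ → Set
GapFree = Linked (λ x y → x ≤ suc y)

InG : ℕ → List ℕ → Set
InG n λ′ = IsPartitionOf n λ′ × GapFree λ′

Odd : ℕ → Set
Odd k = k % 2 ≡ 1

InGI : ℕ → List ℕ → Set
InGI n λ′ = InG n λ′ × last λ′ ≡ just 1 × ∃ (λ k → head λ′ ≡ just k × Odd k)

insert : ℕ → List ℕ → List ℕ
insert x [] = x ∷ []
insert x (y ∷ ys) = if y ≤ᵇ x then x ∷ y ∷ ys else y ∷ insert x ys

sort : List ℕ → List ℕ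
sort = foldr insert []

remove1 : ℕ → List ℕ → List ℕ
remove1 x [] = []
remove1 x (y ∷ ys) = if x ≡ᵇ y then ys else y ∷ remove1 x ys

dedup : List ℕ → List ℕ
dedup [] = []
dedup (x ∷ []) = x ∷ []
dedup (x ∷ y ∷ ys) = if x ≡ᵇ y then dedup (y ∷ ys) else x ∷ dedup (y ∷ ys)

numDistinct : List ℕ → ℕ
numDistinct λ′ = length (dedup λ′)

count : ℕ → List ℕ → ℕ
count x [] = 0
count x (y ∷ ys) = if x ≡ᵇ y then suc (count x ys) else count x ys

mult : List ℕ → ℕ
mult [] = 0
mult (x ∷ xs) = count x (x ∷ xs)

smallestDistinct : ℕ → List ℕ → List ℕ
smallestDistinct r μ = take r (reverse (dedup μ))

ξ : ℕ → List ℕ → List ℕ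
ξ r μ = sort (map suc vs ++ foldr remove1 μ vs)
  where vs = smallestDistinct r μ

iter : ℕ → (List ℕ → List ℕ) → List ℕ → List ℕ
iter zero f x = x
iter (suc k) f x = f (iter k f x)

-- ϱ_i(λ): delete i-1 copies of the largest part (the first i-1 entries
-- of the non-increasing list), then apply ξ_ℓ (i-1) times, ℓ = ℓ̄(λ)
ϱ : ℕ → List ℕ → List ℕ
ϱ i λ′ = iter (i ∸ 1) (ξ (numDistinct λ′)) (drop (i ∸ 1) λ′)

PartitionList : Set
PartitionList = List ℕ

{-# OPTIONS --safe #-}
-- Fix ℓ ≥ 1 and call a gap-free partition ℓ-balanced when it has ℓ or ℓ + 1 distinct parts. If a
-- is its smallest part, the ℓ smallest distinct values are a, a + 1, …, a + ℓ − 1, and bumping each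
-- of them once telescopes: ξ_ℓ just replaces one copy of a by a + ℓ. So ξ_ℓ keeps partitions
-- balanced, raises the sum by ℓ, is injective on them, and its image is exactly the balanced
-- partitions whose largest part exceeds ℓ. Iterating ξ_ℓ backwards, every balanced μ therefore
-- arises uniquely as ξ_ℓ^k(s) with s having parts exactly 1, …, ℓ; and λ = ℓ^k s (k copies of ℓ
-- prepended) is the partition in 𝒢_I with ϱ_{k+1}(λ) = μ. The largest part ℓ of λ is determined
-- by μ, as the unique odd ℓ for which μ is ℓ-balanced.

module Submission where

open import Defs
open import Data.Nat using (ℕ; _≤_)
open import Data.Product using (_×_; ∃)
open import Relation.Binary.PropositionalEquality using (_≡_)

open import Data.Bool using (true; false)
open import Function using (_∘_)
open import Data.List using (List; []; _∷_; _++_; [_]; _∷ʳ_; map; length; take; drop; reverse; foldr; replicate; head; last)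
open import Data.List.Properties using (unfold-reverse; length-reverse; ∷-injective; ∷-injectiveˡ)
open import Data.List.Membership.Propositional using (_∈_)
open import Data.List.Relation.Unary.All using (All; []; _∷_)
open import Data.List.Relation.Unary.Any using (here; there)
open import Data.List.Relation.Unary.Linked using ([]; [-]; _∷_)
open import Data.List.Relation.Unary.Sorted.TotalOrder.Properties using (↗↭↗⇒≋)
open import Data.List.Relation.Binary.Pointwise using (Pointwise-≡⇒≡)
open import Data.List.Relation.Binary.Permutation.Propositional
  using (_↭_; prep; swap; ↭-refl; ↭-trans; ↭⇒↭ₛ; module PermutationReasoning)
open import Data.List.Relation.Binary.Permutation.Propositional.Properties using (++⁺ˡ; ++⁺ʳ; ++-comm; drop-∷; shift)
open import Data.Maybe using (just)
open import Data.Maybe.Properties using (just-injective)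
open import Data.Nat using (suc; zero; _+_; _<_; _≤ᵇ_; _≡ᵇ_; z≤n; s≤s; _<?_)
open import Data.Nat.Induction using (<-wellFounded)
open import Data.Nat.ListAction using (sum)
open import Data.Nat.ListAction.Properties using (sum-↭)
open import Data.Nat.Properties
open import Data.Product using (_,_; ∃₂; ∃-syntax)
open import Data.Sum using (_⊎_; inj₁; inj₂)
open import Induction.WellFounded using (Acc; acc)
open import Relation.Binary.Construct.Flip.EqAndOrd as Flip using ()
open import Relation.Binary.PropositionalEquality using (refl; sym; trans; cong; cong₂; subst; subst₂; _≢_; module ≡-Reasoning)
open import Relation.Nullary using (¬_; yes; no; contradiction)
open import Relation.Nullary.Reflects using (Reflects; ofʸ; ofⁿ; fromEquivalence)

private
  variable
    ℓ ℓ₁ ℓ₂ h a b c d e k n x : ℕ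
    s s₁ s₂ t u w w₁ w₂ : List ℕ

≡ᵇ-reflects-≡ : ∀ m n → Reflects (m ≡ n) (m ≡ᵇ n)
≡ᵇ-reflects-≡ m n = fromEquivalence (≡ᵇ⇒≡ m n) (≡⇒≡ᵇ m n)

insert-↭ : ∀ x xs → insert x xs ↭ x ∷ xs
insert-↭ x [] = ↭-refl
insert-↭ x (y ∷ ys) with y ≤ᵇ x
... | true  = ↭-refl
... | false = ↭-trans (prep y (insert-↭ x ys)) (swap y x ↭-refl)

insert-nonIncreasing : ∀ x {xs} → NonIncreasing xs → NonIncreasing (insert x xs)
insert-nonIncreasing x [] = [-]
insert-nonIncreasing x ([-] {y}) with y ≤ᵇ x | ≤ᵇ-reflects-≤ y x
... | true  | ofʸ y≤x = y≤x ∷ [-]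
... | false | ofⁿ y≰x = <⇒≤ (≰⇒> y≰x) ∷ [-]
insert-nonIncreasing x (_∷_ {y} {z} {zs} z≤y zs↘) with y ≤ᵇ x | ≤ᵇ-reflects-≤ y x
... | true  | ofʸ y≤x = y≤x ∷ z≤y ∷ zs↘
... | false | ofⁿ y≰x with ih ← insert-nonIncreasing x zs↘ | z ≤ᵇ x
...   | true  = <⇒≤ (≰⇒> y≰x) ∷ ih
...   | false = z≤y ∷ ih

sort-↭ : ∀ xs → sort xs ↭ xs
sort-↭ [] = ↭-refl
sort-↭ (x ∷ xs) = ↭-trans (insert-↭ x (sort xs)) (prep x (sort-↭ xs))

sort-nonIncreasing : ∀ xs → NonIncreasing (sort xs)
sort-nonIncreasing [] = []
sort-nonIncreasing (x ∷ xs) = insert-nonIncreasing x (sort-nonIncreasing xs)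

sort-unique : ∀ {xs ys} → xs ↭ ys → NonIncreasing ys → sort xs ≡ ys
sort-unique {xs} xs↭ys ys↘ = Pointwise-≡⇒≡
  (↗↭↗⇒≋ (Flip.totalOrder ≤-totalOrder) (sort-nonIncreasing xs) ys↘ (↭⇒↭ₛ (↭-trans (sort-↭ xs) xs↭ys)))

remove1-↭ : ∀ ys → x ∈ ys → ys ↭ x ∷ remove1 x ys
remove1-↭ {x} (y ∷ ys) x∈ with x ≡ᵇ y | ≡ᵇ-reflects-≡ x y | x∈
... | true  | ofʸ refl | _          = ↭-refl
... | false | ofⁿ x≢y  | here x≡y   = contradiction x≡y x≢y
... | false | ofⁿ _    | there x∈ys = ↭-trans (prep y (remove1-↭ ys x∈ys)) (swap y x ↭-refl)

∈-remove1 : ∀ ys → x ∈ ys → x ≢ a → x ∈ remove1 a ys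
∈-remove1 {a = a} (y ∷ ys) x∈ x≢a with a ≡ᵇ y | ≡ᵇ-reflects-≡ a y | x∈
... | true  | ofʸ refl | here x≡a   = contradiction x≡a x≢a
... | true  | ofʸ refl | there x∈ys = x∈ys
... | false | ofⁿ _    | here x≡y   = here x≡y
... | false | ofⁿ _    | there x∈ys = there (∈-remove1 ys x∈ys x≢a)

count-here : ∀ x t → count x (x ∷ t) ≡ suc (count x t)
count-here x t with x ≡ᵇ x | ≡ᵇ-reflects-≡ x x
... | true  | _       = refl
... | false | ofⁿ x≢x = contradiction refl x≢x

count-there : ∀ t → x ≢ a → count x (a ∷ t) ≡ count x t
count-there {x} {a} t x≢a with x ≡ᵇ a | ≡ᵇ-reflects-≡ x a
... | true  | ofʸ x≡a = contradiction x≡a x≢a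
... | false | _       = refl

count-replicate-++ : ∀ k t → count x (replicate k x ++ t) ≡ k + count x t
count-replicate-++ zero t = refl
count-replicate-++ {x} (suc k) t = trans (count-here x (replicate k x ++ t)) (cong suc (count-replicate-++ k t))

drop-replicate-++ : ∀ k t → drop k (replicate k x ++ t) ≡ t
drop-replicate-++ zero t = refl
drop-replicate-++ (suc k) t = drop-replicate-++ k t

-- Gap-free partitions with prescribed largest and smallest part

data GapFreeParts : ℕ → ℕ → List ℕ → Set where
  single : 0 < a → GapFreeParts a a [ a ]
  cons   : ∀ {h′} → h′ ≤ h → h ≤ suc h′ → GapFreeParts h′ a w → GapFreeParts h a (h ∷ w)

smallest-positive : GapFreeParts h a w → 0 < a
smallest-positive (single 0<a) = 0<a
smallest-positive (cons _ _ p) = smallest-positive p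

smallest≤largest : GapFreeParts h a w → a ≤ h
smallest≤largest (single _) = ≤-refl
smallest≤largest (cons h′≤h _ p) = ≤-trans (smallest≤largest p) h′≤h

largest-head : GapFreeParts h a w → ∃[ t ] w ≡ h ∷ t
largest-head (single _) = [] , refl
largest-head (cons {w = w} _ _ _) = w , refl

head-largest : GapFreeParts h a w → head w ≡ just h
head-largest p with largest-head p
... | _ , refl = refl

last-smallest : GapFreeParts h a w → last w ≡ just a
last-smallest (single _) = refl
last-smallest (cons _ _ p@(single _)) = last-smallest p
last-smallest (cons _ _ p@(cons _ _ _)) = last-smallest p

gapFreeParts⇒nonIncreasing : GapFreeParts h a w → NonIncreasing w
gapFreeParts⇒nonIncreasing (single _) = [-]
gapFreeParts⇒nonIncreasing (cons h′≤h _ p@(single _)) = h′≤h ∷ gapFreeParts⇒nonIncreasing p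
gapFreeParts⇒nonIncreasing (cons h′≤h _ p@(cons _ _ _)) = h′≤h ∷ gapFreeParts⇒nonIncreasing p

gapFreeParts⇒InG : GapFreeParts h a w → InG (sum w) w
gapFreeParts⇒InG p = (gapFreeParts⇒nonIncreasing p , positive p , refl) , gapFree p
  where
  gapFree : GapFreeParts h a w → GapFree w
  gapFree (single _) = [-]
  gapFree (cons _ h≤1+h′ p@(single _)) = h≤1+h′ ∷ gapFree p
  gapFree (cons _ h≤1+h′ p@(cons _ _ _)) = h≤1+h′ ∷ gapFree p

  positive : GapFreeParts h a w → All (0 <_) w
  positive (single 0<a) = 0<a ∷ []
  positive q@(cons _ _ p) = <-≤-trans (smallest-positive q) (smallest≤largest q) ∷ positive p

InG⇒gapFreeParts : InG n (x ∷ t) → ∃[ a ] GapFreeParts x a (x ∷ t)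
InG⇒gapFreeParts ((↘ , pos , _) , gf) = go ↘ pos gf
  where
  go : NonIncreasing (x ∷ t) → All (0 <_) (x ∷ t) → GapFree (x ∷ t) → ∃[ a ] GapFreeParts x a (x ∷ t)
  go {t = []} _ (0<x ∷ []) _ = _ , single 0<x
  go {t = _ ∷ _} (y≤x ∷ ↘) (_ ∷ pos) (x≤1+y ∷ gf) with go ↘ pos gf
  ... | a , p = a , cons y≤x x≤1+y p

∈-gapFreeParts : GapFreeParts h a w → a ≤ x → x ≤ h → x ∈ w
∈-gapFreeParts (single _) a≤x x≤a = here (≤-antisym x≤a a≤x)
∈-gapFreeParts {h = h} {x = x} (cons h′≤h h≤1+h′ p) a≤x x≤h with x ≟ h
... | yes x≡h = here x≡h
... | no x≢h = there (∈-gapFreeParts p a≤x (≤-pred (≤-trans (≤∧≢⇒< x≤h x≢h) h≤1+h′)))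

gapFreeParts-unsnoc : GapFreeParts h a w →
  (h ≡ a × w ≡ [ a ]) ⊎ ∃₂ λ b u → w ≡ u ++ [ a ] × GapFreeParts h b u × a ≤ b × b ≤ suc a
gapFreeParts-unsnoc (single _) = inj₁ (refl , refl)
gapFreeParts-unsnoc (cons h′≤h h≤1+h′ p) with gapFreeParts-unsnoc p
... | inj₁ (refl , refl) = inj₂ (_ , [ _ ] , refl , single (<-≤-trans (smallest-positive p) h′≤h) , h′≤h , h≤1+h′)
... | inj₂ (b , u , refl , q , a≤b , b≤1+a) = inj₂ (b , _ ∷ u , refl , cons h′≤h h≤1+h′ q , a≤b , b≤1+a)

gapFreeParts-snoc : 0 < a → a ≤ b → b ≤ suc a → GapFreeParts h b u → GapFreeParts h a (u ++ [ a ])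
gapFreeParts-snoc 0<a a≤b b≤1+a (single _) = cons a≤b b≤1+a (single 0<a)
gapFreeParts-snoc 0<a a≤b b≤1+a (cons h′≤h h≤1+h′ p) = cons h′≤h h≤1+h′ (gapFreeParts-snoc 0<a a≤b b≤1+a p)

count-above-largest : GapFreeParts h a w → h < x → count x w ≡ 0
count-above-largest (single _) a<x = count-there [] (>⇒≢ a<x)
count-above-largest {w = _ ∷ w} (cons h′≤h _ p) h<x =
  trans (count-there w (>⇒≢ h<x)) (count-above-largest p (≤-<-trans h′≤h h<x))

replicate-prefix : GapFreeParts h a w → k < count h w → ∃[ s ] w ≡ replicate k h ++ s × GapFreeParts h a s
replicate-prefix {k = zero} p _ = _ , refl , p
replicate-prefix {h = h} {k = suc k} (single _) k<c =
  contradiction (subst (suc k <_) (count-here h []) k<c) λ { (s≤s ()) }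
replicate-prefix {h = h} {w = _ ∷ w} {k = suc k} (cons {h′ = h′} h′≤h _ p) k<c with h′ ≟ h
... | yes refl with s , w≡ , q ← replicate-prefix p (≤-pred (subst (suc k <_) (count-here h w) k<c)) =
  s , cong (h ∷_) w≡ , q
... | no h′≢h = contradiction (subst (suc k <_) count≡1 k<c) λ { (s≤s ()) }
  where
  count≡1 : count h (h ∷ w) ≡ 1
  count≡1 = trans (count-here h w) (cong suc (count-above-largest p (≤∧≢⇒< h′≤h h′≢h)))

replicate-gapFreeParts : ∀ k → GapFreeParts h a s → GapFreeParts h a (replicate k h ++ s)
replicate-gapFreeParts zero p = p
replicate-gapFreeParts (suc k) p = cons ≤-refl (n≤1+n _) (replicate-gapFreeParts k p)

interval : ℕ → ℕ → List ℕ
interval a zero = []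
interval a (suc k) = a ∷ interval (suc a) k

length-interval : ∀ a k → length (interval a k) ≡ k
length-interval a zero = refl
length-interval a (suc k) = cong suc (length-interval (suc a) k)

interval-∷ʳ : ∀ a k → interval a (suc k) ≡ interval a k ∷ʳ (a + k)
interval-∷ʳ a zero = cong [_] (sym (+-identityʳ a))
interval-∷ʳ a (suc k) = cong (a ∷_) (trans (interval-∷ʳ (suc a) k) (cong (interval (suc a) k ∷ʳ_) (sym (+-suc a k))))

map-suc-interval : ∀ a k → map suc (interval a k) ≡ interval (suc a) k
map-suc-interval a zero = refl
map-suc-interval a (suc k) = cong (suc a ∷_) (map-suc-interval (suc a) k)

take-interval : ∀ a → k ≤ d → take k (interval a d) ≡ interval a k
take-interval a z≤n = refl
take-interval a (s≤s k≤d) = cong (a ∷_) (take-interval (suc a) k≤d)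

reverse-dedup : GapFreeParts h a w → ∃[ e ] h ≡ a + e × reverse (dedup w) ≡ interval a (suc e)
reverse-dedup {a = a} (single _) = 0 , sym (+-identityʳ a) , refl
reverse-dedup {h = h} {a = a} (cons h′≤h h≤1+h′ p) with largest-head p | reverse-dedup p
... | t , refl | e , refl , rev with h ≡ᵇ (a + e) | ≡ᵇ-reflects-≡ h (a + e)
...   | true  | ofʸ refl = e , refl , rev
...   | false | ofⁿ h≢h′ = suc e , h≡ , (begin
        reverse (h ∷ dedup (a + e ∷ t))    ≡⟨ unfold-reverse h (dedup (a + e ∷ t)) ⟩
        reverse (dedup (a + e ∷ t)) ∷ʳ h   ≡⟨ cong₂ _∷ʳ_ rev h≡ ⟩
        interval a (suc e) ∷ʳ (a + suc e)  ≡⟨ interval-∷ʳ a (suc e) ⟨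
        interval a (suc (suc e))           ∎)
  where
  open ≡-Reasoning
  h≡ : h ≡ a + suc e
  h≡ = trans (≤-antisym h≤1+h′ (≤∧≢⇒< h′≤h (h≢h′ ∘ sym))) (sym (+-suc a e))

numDistinct-gapFreeParts : GapFreeParts h a w → ∃[ e ] h ≡ a + e × numDistinct w ≡ suc e
numDistinct-gapFreeParts {a = a} {w = w} p with reverse-dedup p
... | e , h≡ , rev = e , h≡ , (begin
  length (dedup w)            ≡⟨ length-reverse (dedup w) ⟨
  length (reverse (dedup w))  ≡⟨ cong length rev ⟩
  length (interval a (suc e)) ≡⟨ length-interval a (suc e) ⟩
  suc e                       ∎)
  where open ≡-Reasoning

numDistinct-base : GapFreeParts ℓ 1 s → numDistinct s ≡ ℓ
numDistinct-base p with numDistinct-gapFreeParts p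
... | e , refl , nd = nd

-- ξ ℓ as a rotation

∈-remove1-interval : ∀ k → x < b → x ∈ w → x ∈ foldr remove1 w (interval b k)
∈-remove1-interval zero _ x∈ = x∈
∈-remove1-interval (suc k) x<b x∈ = ∈-remove1 _ (∈-remove1-interval k (m<n⇒m<1+n x<b) x∈) (<⇒≢ x<b)

↭-remove1-interval : ∀ a k → (∀ {x} → a ≤ x → x < a + k → x ∈ w) →
                     w ↭ interval a k ++ foldr remove1 w (interval a k)
↭-remove1-interval a zero _ = ↭-refl
↭-remove1-interval {w} a (suc k) contains = begin
  w                                      ↭⟨ ↭-remove1-interval (suc a) k contains′ ⟩
  interval (suc a) k ++ F                ↭⟨ ++⁺ˡ (interval (suc a) k) (remove1-↭ F a∈F) ⟩
  interval (suc a) k ++ a ∷ remove1 a F  ↭⟨ shift a (interval (suc a) k) (remove1 a F) ⟩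
  a ∷ interval (suc a) k ++ remove1 a F  ∎
  where
  open PermutationReasoning
  F : List ℕ
  F = foldr remove1 w (interval (suc a) k)
  contains′ : ∀ {x} → suc a ≤ x → x < suc a + k → x ∈ w
  contains′ {x} a<x x< = contains (<⇒≤ a<x) (subst (x <_) (sym (+-suc a k)) x<)
  a∈F : a ∈ F
  a∈F = ∈-remove1-interval k ≤-refl (contains ≤-refl (m<m+n a (s≤s z≤n)))

map-suc-interval-↭ : ∀ a k → map suc (interval a (suc k)) ↭ (a + suc k) ∷ interval (suc a) k
map-suc-interval-↭ a k = begin
  map suc (interval a (suc k))        ≡⟨ map-suc-interval a (suc k) ⟩
  interval (suc a) (suc k)            ≡⟨ interval-∷ʳ (suc a) k ⟩
  interval (suc a) k ++ [ suc a + k ] ↭⟨ ++-comm (interval (suc a) k) [ suc a + k ] ⟩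
  suc a + k ∷ interval (suc a) k      ≡⟨ cong (_∷ interval (suc a) k) (+-suc a k) ⟨
  a + suc k ∷ interval (suc a) k      ∎
  where open PermutationReasoning

-- Bumping each of a, a + 1, …, a + k once amounts to trading one copy of a for a + k + 1.
bump-interval-↭ : ∀ a k → (∀ {x} → a ≤ x → x < a + suc k → x ∈ u ++ [ a ]) →
                  map suc (interval a (suc k)) ++ foldr remove1 (u ++ [ a ]) (interval a (suc k)) ↭ (a + suc k) ∷ u
bump-interval-↭ {u} a k contains = begin
  map suc (interval a (suc k)) ++ R     ↭⟨ ++⁺ʳ R (map-suc-interval-↭ a k) ⟩
  a + suc k ∷ interval (suc a) k ++ R   ↭⟨ prep (a + suc k) (drop-∷ u↭) ⟨
  a + suc k ∷ u                         ∎
  where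
  open PermutationReasoning
  R : List ℕ
  R = foldr remove1 (u ++ [ a ]) (interval a (suc k))
  u↭ : a ∷ u ↭ a ∷ interval (suc a) k ++ R
  u↭ = ↭-trans (++-comm [ a ] u) (↭-remove1-interval a (suc k) contains)

ξ-rotation : 1 ≤ ℓ → GapFreeParts h a (u ++ [ a ]) → a + ℓ ≤ suc h → NonIncreasing ((a + ℓ) ∷ u) →
             ξ ℓ (u ++ [ a ]) ≡ (a + ℓ) ∷ u
ξ-rotation {ℓ = suc k} {a = a} {u} _ p a+ℓ≤1+h ↘ with reverse-dedup p
... | e , refl , rev = begin
  ξ (suc k) (u ++ [ a ])         ≡⟨ cong bump smallest ⟩
  bump (interval a (suc k))      ≡⟨ sort-unique perm ↘ ⟩
  a + suc k ∷ u                  ∎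
  where
  open ≡-Reasoning
  bump : List ℕ → List ℕ
  bump vs = sort (map suc vs ++ foldr remove1 (u ++ [ a ]) vs)
  smallest : smallestDistinct (suc k) (u ++ [ a ]) ≡ interval a (suc k)
  smallest = trans (cong (take (suc k)) rev)
    (take-interval a (+-cancelˡ-≤ a _ _ (subst (a + suc k ≤_) (sym (+-suc a e)) a+ℓ≤1+h)))
  perm : map suc (interval a (suc k)) ++ foldr remove1 (u ++ [ a ]) (interval a (suc k)) ↭ (a + suc k) ∷ u
  perm = bump-interval-↭ a k (λ a≤x x< → ∈-gapFreeParts p a≤x (≤-pred (≤-trans x< a+ℓ≤1+h)))

-- ℓ ≤ numDistinct w ≤ ℓ + 1, phrased through the largest and smallest parts.
record Balanced (ℓ : ℕ) (w : List ℕ) : Set where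
  constructor balanced
  field
    largest smallest : ℕ
    parts : GapFreeParts largest smallest w
    largest≤ : largest ≤ smallest + ℓ
    ≤1+largest : smallest + ℓ ≤ suc largest

+-≤-suc-transfer : ∀ a b → a + ℓ ≤ suc a → b + ℓ ≤ suc b
+-≤-suc-transfer {ℓ} a b a+ℓ≤1+a = ≤-trans (+-monoʳ-≤ b ℓ≤1) (≤-reflexive (+-comm b 1))
  where
  ℓ≤1 : ℓ ≤ 1
  ℓ≤1 = +-cancelˡ-≤ a ℓ 1 (≤-trans a+ℓ≤1+a (≤-reflexive (+-comm 1 a)))

window⇒balanced : GapFreeParts (a + e) a w → e ≤ ℓ → ℓ ≤ suc e → Balanced ℓ w
window⇒balanced {a} {e} p e≤ℓ ℓ≤1+e =
  balanced _ a p (+-monoʳ-≤ a e≤ℓ) (≤-trans (+-monoʳ-≤ a ℓ≤1+e) (≤-reflexive (+-suc a e)))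

balanced-numDistinct : Balanced ℓ w → numDistinct w ≡ ℓ ⊎ numDistinct w ≡ suc ℓ
balanced-numDistinct {ℓ} (balanced _ a p largest≤ ≤1+largest) with numDistinct-gapFreeParts p
... | e , refl , nd with m≤n⇒m<n∨m≡n (+-cancelˡ-≤ a ℓ (suc e) (subst (a + ℓ ≤_) (sym (+-suc a e)) ≤1+largest))
... | inj₁ ℓ<1+e = inj₂ (trans nd (cong suc (≤-antisym (+-cancelˡ-≤ a e ℓ largest≤) (≤-pred ℓ<1+e))))
... | inj₂ ℓ≡1+e = inj₁ (trans nd (sym ℓ≡1+e))

singleton-balanced : 0 < x → x + ℓ ≤ suc x → Balanced ℓ [ x ]
singleton-balanced {x} {ℓ} 0<x = balanced x x (single 0<x) (m≤m+n x ℓ)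

ξ-step : 1 ≤ ℓ → (bal : Balanced ℓ w) → let a = Balanced.smallest bal in
         ∃[ u ] w ≡ u ++ [ a ] × ξ ℓ w ≡ (a + ℓ) ∷ u × Balanced ℓ ((a + ℓ) ∷ u)
ξ-step {ℓ} 1≤ℓ (balanced _ a p largest≤ ≤1+largest) with gapFreeParts-unsnoc p
... | inj₁ (refl , refl) =
  [] , refl , ξ-rotation 1≤ℓ p ≤1+largest [-] ,
  singleton-balanced (<-≤-trans (smallest-positive p) (m≤m+n a ℓ)) (+-≤-suc-transfer a (a + ℓ) ≤1+largest)
... | inj₂ (b , u , refl , q , a≤b , b≤1+a) =
  u , refl , ξ-rotation 1≤ℓ p ≤1+largest (gapFreeParts⇒nonIncreasing p′) ,
  balanced (a + ℓ) b p′ (+-monoˡ-≤ ℓ a≤b) (+-monoˡ-≤ ℓ b≤1+a)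
  where
  p′ : GapFreeParts (a + ℓ) b ((a + ℓ) ∷ u)
  p′ = cons largest≤ ≤1+largest q

ξ-step⁻¹ : 1 ≤ ℓ → 0 < c → Balanced ℓ ((c + ℓ) ∷ u) →
           Balanced ℓ (u ++ [ c ]) × ξ ℓ (u ++ [ c ]) ≡ (c + ℓ) ∷ u
ξ-step⁻¹ {ℓ} {c} 1≤ℓ 0<c (balanced _ _ (single _) _ ≤1+largest) =
  singleton-balanced 0<c c+ℓ≤1+c , ξ-rotation 1≤ℓ (single 0<c) c+ℓ≤1+c [-]
  where
  c+ℓ≤1+c : c + ℓ ≤ suc c
  c+ℓ≤1+c = +-≤-suc-transfer (c + ℓ) c ≤1+largest
ξ-step⁻¹ {ℓ} {c} {u} 1≤ℓ 0<c (balanced _ b p@(cons {h′ = h} h≤c+ℓ c+ℓ≤1+h q) largest≤ ≤1+largest) =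
  balanced _ c q′ h≤c+ℓ c+ℓ≤1+h , ξ-rotation 1≤ℓ q′ c+ℓ≤1+h (gapFreeParts⇒nonIncreasing p)
  where
  q′ : GapFreeParts h c (u ++ [ c ])
  q′ = gapFreeParts-snoc 0<c (+-cancelʳ-≤ ℓ c b largest≤) (+-cancelʳ-≤ ℓ b (suc c) ≤1+largest) q

ξ-balanced : 1 ≤ ℓ → Balanced ℓ w → Balanced ℓ (ξ ℓ w)
ξ-balanced 1≤ℓ bal with ξ-step 1≤ℓ bal
... | _ , _ , ξ≡ , bal′ = subst (Balanced _) (sym ξ≡) bal′

ξ-sum : 1 ≤ ℓ → Balanced ℓ w → sum (ξ ℓ w) ≡ ℓ + sum w
ξ-sum {ℓ} 1≤ℓ bal@(balanced _ a _ _ _) with ξ-step 1≤ℓ bal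
... | u , refl , ξ≡ , _ = begin
  sum (ξ ℓ (u ++ [ a ]))  ≡⟨ cong sum ξ≡ ⟩
  a + ℓ + sum u           ≡⟨ cong (_+ sum u) (+-comm a ℓ) ⟩
  ℓ + a + sum u           ≡⟨ +-assoc ℓ a (sum u) ⟩
  ℓ + (a + sum u)         ≡⟨ cong (ℓ +_) (sum-↭ (++-comm u [ a ])) ⟨
  ℓ + sum (u ++ [ a ])    ∎
  where open ≡-Reasoning

sum<sum-ξ : 1 ≤ ℓ → Balanced ℓ w → sum w < sum (ξ ℓ w)
sum<sum-ξ {w = w} 1≤ℓ bal = subst (sum w <_) (sym (ξ-sum 1≤ℓ bal)) (m<n+m (sum w) 1≤ℓ)

ξ-largest> : 1 ≤ ℓ → Balanced ℓ w → ξ ℓ w ≡ x ∷ t → ℓ < x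
ξ-largest> {ℓ} 1≤ℓ bal@(balanced _ _ p _ _) eq with ξ-step 1≤ℓ bal
... | _ , _ , ξ≡ , _ = subst (ℓ <_) (∷-injectiveˡ (trans (sym ξ≡) eq)) (m<n+m ℓ (smallest-positive p))

ξ-injective : 1 ≤ ℓ → Balanced ℓ w₁ → Balanced ℓ w₂ → ξ ℓ w₁ ≡ ξ ℓ w₂ → w₁ ≡ w₂
ξ-injective {ℓ} 1≤ℓ bal₁@(balanced _ _ _ _ _) bal₂@(balanced _ _ _ _ _) eq with ξ-step 1≤ℓ bal₁ | ξ-step 1≤ℓ bal₂
... | u₁ , refl , ξ≡₁ , _ | u₂ , refl , ξ≡₂ , _ with ∷-injective (trans (sym ξ≡₁) (trans eq ξ≡₂))
... | a₁+ℓ≡a₂+ℓ , refl = cong (λ a → u₁ ++ [ a ]) (+-cancelʳ-≡ ℓ _ _ a₁+ℓ≡a₂+ℓ)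

iter-ξ-balanced : 1 ≤ ℓ → Balanced ℓ w → ∀ k → Balanced ℓ (iter k (ξ ℓ) w)
iter-ξ-balanced 1≤ℓ bal zero = bal
iter-ξ-balanced 1≤ℓ bal (suc k) = ξ-balanced 1≤ℓ (iter-ξ-balanced 1≤ℓ bal k)

iter-ξ-sum : 1 ≤ ℓ → Balanced ℓ w → ∀ k → sum (iter k (ξ ℓ) w) ≡ sum (replicate k ℓ ++ w)
iter-ξ-sum 1≤ℓ bal zero = refl
iter-ξ-sum {ℓ} 1≤ℓ bal (suc k) =
  trans (ξ-sum 1≤ℓ (iter-ξ-balanced 1≤ℓ bal k)) (cong (ℓ +_) (iter-ξ-sum 1≤ℓ bal k))

-- Orbits of ξ ℓ

base-balanced : GapFreeParts ℓ 1 s → Balanced ℓ s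
base-balanced p = balanced _ 1 p (n≤1+n _) ≤-refl

base≢ξ : 1 ≤ ℓ → GapFreeParts ℓ a s → Balanced ℓ w → s ≢ ξ ℓ w
base≢ξ 1≤ℓ p bal s≡ξ with largest-head p
... | _ , refl = <-irrefl refl (ξ-largest> 1≤ℓ bal (sym s≡ξ))

base-orbit-balanced : GapFreeParts ℓ 1 s → ∀ k → Balanced ℓ (iter k (ξ ℓ) s)
base-orbit-balanced p = iter-ξ-balanced (smallest≤largest p) (base-balanced p)

iter-ξ-cancel : GapFreeParts ℓ 1 s₁ → GapFreeParts ℓ 1 s₂ →
                ∀ k₁ k₂ → iter k₁ (ξ ℓ) s₁ ≡ iter k₂ (ξ ℓ) s₂ → k₁ ≡ k₂ × s₁ ≡ s₂
iter-ξ-cancel p₁ p₂ zero zero eq = refl , eq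
iter-ξ-cancel p₁ p₂ zero (suc k₂) eq =
  contradiction eq (base≢ξ (smallest≤largest p₁) p₁ (base-orbit-balanced p₂ k₂))
iter-ξ-cancel p₁ p₂ (suc k₁) zero eq =
  contradiction (sym eq) (base≢ξ (smallest≤largest p₂) p₂ (base-orbit-balanced p₁ k₁))
iter-ξ-cancel p₁ p₂ (suc k₁) (suc k₂) eq
  with refl , s₁≡s₂ ← iter-ξ-cancel p₁ p₂ k₁ k₂
         (ξ-injective (smallest≤largest p₁) (base-orbit-balanced p₁ k₁) (base-orbit-balanced p₂ k₂) eq)
  = refl , s₁≡s₂

balanced-base : Balanced ℓ (h ∷ u) → h ≤ ℓ → GapFreeParts ℓ 1 (h ∷ u)
balanced-base {ℓ} (balanced _ a p _ ≤1+largest) h≤ℓ with largest-head p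
... | _ , refl with ≤-antisym (+-cancelʳ-≤ ℓ a 1 (≤-trans ≤1+largest (s≤s h≤ℓ))) (smallest-positive p)
... | refl with ≤-antisym h≤ℓ (≤-pred ≤1+largest)
... | refl = p

m<n⇒∃[o]o+m≡n : ∀ {m n} → m < n → ∃[ o ] 0 < o × o + m ≡ n
m<n⇒∃[o]o+m≡n m<n = _ , m<n⇒0<n∸m m<n , m∸n+n≡m (<⇒≤ m<n)

ξ-descent : 1 ≤ ℓ → Balanced ℓ t → ∃₂ λ k s → GapFreeParts ℓ 1 s × iter k (ξ ℓ) s ≡ t
ξ-descent {ℓ} 1≤ℓ bal = go bal (<-wellFounded _)
  where
  go : Balanced ℓ t → Acc _<_ (sum t) → ∃₂ λ k s → GapFreeParts ℓ 1 s × iter k (ξ ℓ) s ≡ t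
  go {t = []} (balanced _ _ () _ _) _
  go {t = h ∷ u} bal (acc smaller) with ℓ <? h
  ... | no ℓ≮h = 0 , h ∷ u , balanced-base bal (≮⇒≥ ℓ≮h) , refl
  ... | yes ℓ<h with m<n⇒∃[o]o+m≡n ℓ<h
  ... | c , 0<c , refl with ξ-step⁻¹ 1≤ℓ 0<c bal
  ... | bal′ , ξ≡ with go bal′ (smaller (subst (λ v → sum (u ++ [ c ]) < sum v) ξ≡ (sum<sum-ξ 1≤ℓ bal′)))
  ... | k , s , p , iter≡ = suc k , s , p , trans (cong (ξ ℓ) iter≡) ξ≡

-- The sets 𝒢_λ

odd⇒0< : Odd n → 0 < n
odd⇒0< {suc _} _ = s≤s z≤n

odd⇒¬odd-suc : ∀ n → Odd n → ¬ Odd (suc n)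
odd⇒¬odd-suc (suc zero) _ ()
odd⇒¬odd-suc (suc (suc n)) = odd⇒¬odd-suc n

odd⊎odd-suc : ∀ n → Odd n ⊎ Odd (suc n)
odd⊎odd-suc zero = inj₂ refl
odd⊎odd-suc (suc zero) = inj₁ refl
odd⊎odd-suc (suc (suc n)) = odd⊎odd-suc n

odd-window : ∀ e → ∃[ ℓ ] Odd ℓ × e ≤ ℓ × ℓ ≤ suc e
odd-window e with odd⊎odd-suc e
... | inj₁ odd = e , odd , ≤-refl , n≤1+n e
... | inj₂ odd = suc e , odd , n≤1+n e , ≤-refl

odd-balanced-unique : Odd ℓ₁ → Odd ℓ₂ → Balanced ℓ₁ w → Balanced ℓ₂ w → ℓ₁ ≡ ℓ₂
odd-balanced-unique {ℓ₁} {ℓ₂} odd₁ odd₂ bal₁ bal₂ with balanced-numDistinct bal₁ | balanced-numDistinct bal₂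
... | inj₁ d≡ℓ₁ | inj₁ d≡ℓ₂ = trans (sym d≡ℓ₁) d≡ℓ₂
... | inj₁ d≡ℓ₁ | inj₂ d≡1+ℓ₂ = contradiction (subst Odd (trans (sym d≡ℓ₁) d≡1+ℓ₂) odd₁) (odd⇒¬odd-suc ℓ₂ odd₂)
... | inj₂ d≡1+ℓ₁ | inj₁ d≡ℓ₂ = contradiction (subst Odd (trans (sym d≡ℓ₂) d≡1+ℓ₁) odd₂) (odd⇒¬odd-suc ℓ₁ odd₁)
... | inj₂ d≡1+ℓ₁ | inj₂ d≡1+ℓ₂ = suc-injective (trans (sym d≡1+ℓ₁) d≡1+ℓ₂)

mult-largest : GapFreeParts h a w → mult w ≡ count h w
mult-largest p with largest-head p
... | _ , refl = refl

<mult-replicate : ∀ k → GapFreeParts h a s → k < mult (replicate k h ++ s)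
<mult-replicate {h} k p with largest-head p
... | t , refl = subst (k <_) (sym mult≡) (m<m+n k (s≤s z≤n))
  where
  mult≡ : mult (replicate k h ++ h ∷ t) ≡ k + suc (count h t)
  mult≡ = trans (mult-largest (replicate-gapFreeParts k p))
                (trans (count-replicate-++ k (h ∷ t)) (cong (k +_) (count-here h t)))

InGI-split : ∀ λ′ → InGI n λ′ → k < mult λ′ → ∃₂ λ ℓ s → Odd ℓ × GapFreeParts ℓ 1 s × λ′ ≡ replicate k ℓ ++ s
InGI-split (x ∷ xs) (g , last≡1 , _ , refl , odd) k<mult with InG⇒gapFreeParts g
... | a , p with just-injective (trans (sym (last-smallest p)) last≡1)
... | refl with replicate-prefix p k<mult
... | s , λ≡ , q = x , s , odd , q , λ≡

InGI-replicate : ∀ k → Odd ℓ → GapFreeParts ℓ 1 s → InGI (sum (replicate k ℓ ++ s)) (replicate k ℓ ++ s)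
InGI-replicate {ℓ = ℓ} {s = s} k odd p = gapFreeParts⇒InG p′ , last-smallest p′ , ℓ , head-largest p′ , odd
  where
  p′ : GapFreeParts ℓ 1 (replicate k ℓ ++ s)
  p′ = replicate-gapFreeParts k p

ϱ-replicate : ∀ k → GapFreeParts ℓ 1 s → ϱ (suc k) (replicate k ℓ ++ s) ≡ iter k (ξ ℓ) s
ϱ-replicate k p =
  cong₂ (λ d v → iter k (ξ d) v) (numDistinct-base (replicate-gapFreeParts k p)) (drop-replicate-++ k _)

ϱ-InG : ∀ λ′ → InGI n λ′ → ∀ i → 1 ≤ i → i ≤ mult λ′ → InG n (ϱ i λ′)
ϱ-InG λ′ gi@(((_ , _ , refl) , _) , _) (suc k) _ k<mult with InGI-split λ′ gi k<mult
... | ℓ , s , _ , p , refl =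
  subst₂ InG (iter-ξ-sum (smallest≤largest p) (base-balanced p) k) (sym (ϱ-replicate k p))
    (gapFreeParts⇒InG (Balanced.parts (base-orbit-balanced p k)))

ϱ-disjoint : ∀ λ₁ λ₂ → InGI n λ₁ → InGI n λ₂ → ∀ i j → 1 ≤ i → i ≤ mult λ₁ → 1 ≤ j → j ≤ mult λ₂ →
             ϱ i λ₁ ≡ ϱ j λ₂ → λ₁ ≡ λ₂
ϱ-disjoint λ₁ λ₂ gi₁ gi₂ (suc k₁) (suc k₂) _ k₁<mult _ k₂<mult eq
  with ℓ₁ , s₁ , odd₁ , p₁ , refl ← InGI-split λ₁ gi₁ k₁<mult
  with ℓ₂ , s₂ , odd₂ , p₂ , refl ← InGI-split λ₂ gi₂ k₂<mult
  with orbit≡ ← trans (sym (ϱ-replicate k₁ p₁)) (trans eq (ϱ-replicate k₂ p₂))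
  with refl ← odd-balanced-unique odd₁ odd₂ (base-orbit-balanced p₁ k₁)
                (subst (Balanced ℓ₂) (sym orbit≡) (base-orbit-balanced p₂ k₂))
  with refl , refl ← iter-ξ-cancel p₁ p₂ k₁ k₂ orbit≡
  = refl

ϱ-covers : 1 ≤ n → ∀ μ → InG n μ → ∃[ λ′ ] InGI n λ′ × ∃[ i ] 1 ≤ i × i ≤ mult λ′ × ϱ i λ′ ≡ μ
ϱ-covers 1≤n [] ((_ , _ , refl) , _) = contradiction 1≤n λ ()
ϱ-covers _ (x ∷ xs) g@((_ , _ , refl) , _) with InG⇒gapFreeParts g
... | a , p with numDistinct-gapFreeParts p
... | e , refl , _ with odd-window e
... | ℓ , odd , e≤ℓ , ℓ≤1+e with ξ-descent (odd⇒0< odd) (window⇒balanced p e≤ℓ ℓ≤1+e)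
... | k , s , q , orbit≡ =
  replicate k ℓ ++ s ,
  subst (λ n → InGI n (replicate k ℓ ++ s))
    (trans (sym (iter-ξ-sum (smallest≤largest q) (base-balanced q) k)) (cong sum orbit≡))
    (InGI-replicate k odd q) ,
  suc k , s≤s z≤n , <mult-replicate k q , trans (ϱ-replicate k q) orbit≡

theorem5p3 : (n : ℕ) → 1 ≤ n →
    -- each 𝒢_λ (λ ∈ 𝒢_I(n)) is contained in 𝒢(n)
    ((λ′ : PartitionList) → InGI n λ′ → (i : ℕ) → 1 ≤ i → i ≤ mult λ′ → InG n (ϱ i λ′))
    -- the sets 𝒢_λ are pairwise disjoint
    × ((λ₁ λ₂ : PartitionList) → InGI n λ₁ → InGI n λ₂ →
         (i j : ℕ) → 1 ≤ i → i ≤ mult λ₁ → 1 ≤ j → j ≤ mult λ₂ →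
         ϱ i λ₁ ≡ ϱ j λ₂ → λ₁ ≡ λ₂)
    -- every gap-free partition of n lies in some 𝒢_λ
    × ((μ : PartitionList) → InG n μ →
         ∃ (λ λ′ → InGI n λ′ × ∃ (λ i → 1 ≤ i × i ≤ mult λ′ × ϱ i λ′ ≡ μ)))
theorem5p3 n 1≤n = ϱ-InG , ϱ-disjoint , ϱ-covers 1≤n
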